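{- Let $g_1,\dots,g_n$ be non-constant Boolean functions with $\mathrm{Rank}(g_i)=r_i$, and let $f:\{0,1\}^n\to\{0,1\}$ be a non-constant symmetric Boolean function. Then $$\sum_{i=1}^n r_i-(n-1)\le \mathrm{Rank}(f\circ(g_1,\dots,g_n))\le \sum_{i=1}^n r_i.$$
   Context: A Boolean function is symmetric if its value depends only on the Hamming weight of the input. Decision trees query single variables at internal nodes and have $0/1$-labelled leaves. The rank of a rooted binary tree: leaves have rank $0$; an internal node with children of ranks $a,b$ has rank $a+1$ if $a=b$, else $\max\{a,b\}$; $\mathrm{Rank}(h)$ is the minimum rank of a decision tree computing $h$. For $g_i$ of arity $m_i$, $f\circ(g_1,\dots,g_n)(a^1,\dots,a^n)=f(g_1(a^1),\dots,g_n(a^n))$ with $a^i\in\{0,1\}^{m_i}$. -}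

module Defs where

open import Data.Bool using (Bool; true; false; if_then_else_)
open import Data.Nat using (ℕ; zero; suc; _+_; _≤_; _⊔_)
open import Data.Fin using (Fin; zero; suc)
open import Data.Product using (Σ; ∃; ∃-syntax; _×_; _,_)
open import Relation.Binary.PropositionalEquality using (_≡_; _≢_)

BoolFn : Set → Set
BoolFn V = (V → Bool) → Bool

data DTree (V : Set) : Set where
  leaf : Bool → DTree V
  node : V → DTree V → DTree V → DTree V

eval : {V : Set} → DTree V → (V → Bool) → Bool
eval (leaf b)       x = b
eval (node v t₀ t₁) x = if x v then eval t₁ x else eval t₀ x

rankNode : ℕ → ℕ → ℕ
rankNode zero    zero    = 1
rankNode zero    (suc b) = suc b
rankNode (suc a) zero    = suc a
rankNode (suc a) (suc b) = suc (rankNode a b)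

rank : {V : Set} → DTree V → ℕ
rank (leaf _)       = 0
rank (node _ t₀ t₁) = rankNode (rank t₀) (rank t₁)

Computes : {V : Set} → DTree V → BoolFn V → Set
Computes {V} t h = (x : V → Bool) → eval t x ≡ h x

IsRank : {V : Set} → BoolFn V → ℕ → Set
IsRank {V} h r =
  (Σ (DTree V) λ t → Computes t h × rank t ≡ r) ×
  ((t : DTree V) → Computes t h → r ≤ rank t)

NonConstant : {V : Set} → BoolFn V → Set
NonConstant {V} h = ∃[ x ] ∃[ y ] (h x ≢ h y)

weight : {n : ℕ} → (Fin n → Bool) → ℕ
weight {zero}  x = 0
weight {suc n} x = (if x zero then 1 else 0) + weight {n} (λ i → x (suc i))

Symmetric : {n : ℕ} → BoolFn (Fin n) → Set
Symmetric {n} f = (x y : Fin n → Bool) → weight x ≡ weight y → f x ≡ f y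

-- f ∘ (g₁,…,gₙ): variables of the composed function are pairs (i , j), j a variable of gᵢ
compose : {n : ℕ} {m : Fin n → ℕ} → BoolFn (Fin n) → ((i : Fin n) → BoolFn (Fin (m i)))
        → BoolFn (Σ (Fin n) λ i → Fin (m i))
compose f g a = f (λ i → g i (λ j → a (i , j)))

∑ : {n : ℕ} → (Fin n → ℕ) → ℕ
∑ {zero}  r = 0
∑ {suc n} r = r zero + ∑ {n} (λ i → r (suc i))

{-# OPTIONS --safe #-}
-- Upper bound: below every leaf of a tree for g₁, graft a tree for f ∘ (g₂, …, gₙ) with the value of
-- g₁ plugged into f; grafting adds the rank of the lower trees to that of the upper one.
--
-- Lower bound: an adversary argument. Along a tree for f ∘ h, where hᵢ is gᵢ with some variables fixed,
-- keep budgets kᵢ such that every hᵢ has rank > kᵢ or is constant with kᵢ = 0, and f ∘ h is not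
-- constant; then the tree has rank > Σ kᵢ, which gives the bound for kᵢ = rᵢ − 1. At a query of a
-- variable of block i, follow a branch on which the restriction of hᵢ still has rank > kᵢ. If there is
-- none, both restrictions have rank kᵢ: for kᵢ > 0 both branches continue with budget kᵢ − 1, so the
-- node gains one rank; for kᵢ = 0 both restrictions are constant, and fixing block i on one of the two
-- branches leaves f ∘ h non-constant by the symmetry of f, unless all other blocks are constant, in
-- which case Σ kᵢ = 0.
module Submission where

open import Defs
open import Data.Bool using (Bool; true; false; if_then_else_; not) renaming (_≟_ to _≟ᴮ_)
open import Data.Bool.Properties using (¬-not; not-injective)
open import Data.Fin using (Fin; zero; suc) renaming (_≟_ to _≟ᶠ_)
open import Data.Fin.Permutation using (Permutation; _⟨$⟩ʳ_; transpose)
import Data.Fin.Permutation.Components as PC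
open import Data.Nat using (ℕ; zero; suc; pred; _+_; _∸_; >-nonZero; _⊔_; _≤_; _<_; z≤n; s≤s)
open import Data.Nat.Properties
open import Algebra.Properties.CommutativeMonoid.Sum +-0-commutativeMonoid using (sum; sum-permute)
open import Data.Product using (Σ; ∃; _,_; _×_; proj₁; proj₂; uncurry)
open import Data.Product.Properties using (≡-dec)
open import Data.Sum using (_⊎_; inj₁; inj₂)
open import Data.Vec.Functional using (_∷_; updateAt)
open import Data.Vec.Functional.Properties using (updateAt-updates; updateAt-minimal)
open import Data.Empty using (⊥-elim)
open import Function using (_∘_; const)
open import Relation.Binary.Core using (_Preserves_⟶_)
open import Relation.Binary.Definitions using (DecidableEquality)
open import Relation.Binary.PropositionalEquality
open import Relation.Nullary using (¬_; Dec; yes; no; contradiction)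
open import Relation.Nullary.Decidable using (decidable-stable; dec-true; dec-false)

rankNode-comm : ∀ a b → rankNode a b ≡ rankNode b a
rankNode-comm zero    zero    = refl
rankNode-comm zero    (suc b) = refl
rankNode-comm (suc a) zero    = refl
rankNode-comm (suc a) (suc b) = cong suc (rankNode-comm a b)

rankNode-pos : ∀ a b → 1 ≤ rankNode a b
rankNode-pos zero    zero    = s≤s z≤n
rankNode-pos zero    (suc b) = s≤s z≤n
rankNode-pos (suc a) zero    = s≤s z≤n
rankNode-pos (suc a) (suc b) = s≤s z≤n

rankNode-≥ˡ : ∀ a b → a ≤ rankNode a b
rankNode-≥ˡ zero    b       = z≤n
rankNode-≥ˡ (suc a) zero    = ≤-refl
rankNode-≥ˡ (suc a) (suc b) = s≤s (rankNode-≥ˡ a b)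

rankNode-≥ʳ : ∀ a b → b ≤ rankNode a b
rankNode-≥ʳ a b = subst (b ≤_) (rankNode-comm b a) (rankNode-≥ˡ b a)

rankNode-suc : ∀ {p a b} → p ≤ a → p ≤ b → suc p ≤ rankNode a b
rankNode-suc {zero}  {a}     {b}     _         _         = rankNode-pos a b
rankNode-suc {suc p} {suc a} {suc b} (s≤s p≤a) (s≤s p≤b) = s≤s (rankNode-suc p≤a p≤b)

rankNode-≤ : ∀ {a b k} → a < k → b ≤ k → rankNode a b ≤ k
rankNode-≤ {zero}  {zero}  (s≤s _)   _         = s≤s z≤n
rankNode-≤ {zero}  {suc b} _         b≤k       = b≤k
rankNode-≤ {suc a} {zero}  a<k       _         = <⇒≤ a<k
rankNode-≤ {suc a} {suc b} (s≤s a<k) (s≤s b≤k) = s≤s (rankNode-≤ a<k b≤k)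

suc≤rankNode⇒≤ˡ : ∀ {a b k} → suc k ≤ rankNode a b → b ≤ k → k ≤ a
suc≤rankNode⇒≤ˡ k<node b≤k = ≮⇒≥ λ a<k → <-irrefl refl (<-≤-trans k<node (rankNode-≤ a<k b≤k))

suc≤rankNode⇒≤ʳ : ∀ {a b k} → suc k ≤ rankNode a b → a ≤ k → k ≤ b
suc≤rankNode⇒≤ʳ {a} {b} k<node = suc≤rankNode⇒≤ˡ (subst (_ ≤_) (rankNode-comm a b) k<node)

rankNode-mono : ∀ {a a′ b b′} → a ≤ a′ → b ≤ b′ → rankNode a b ≤ rankNode a′ b′
rankNode-mono {zero}  {a′} {zero}  {b′} _ _     = rankNode-pos a′ b′
rankNode-mono {zero}  {a′} {suc b} {b′} _ b≤b′  = ≤-trans b≤b′ (rankNode-≥ʳ a′ b′)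
rankNode-mono {suc a} {a′} {zero}  {b′} a≤a′ _  = ≤-trans a≤a′ (rankNode-≥ˡ a′ b′)
rankNode-mono {suc a} {suc a′} {suc b} {suc b′} (s≤s a≤a′) (s≤s b≤b′) =
  s≤s (rankNode-mono a≤a′ b≤b′)

rankNode-+ : ∀ c a b → rankNode (c + a) (c + b) ≡ c + rankNode a b
rankNode-+ zero    a b = refl
rankNode-+ (suc c) a b = cong suc (rankNode-+ c a b)

suc≤⇒+≤+∸1 : ∀ {s R} n → suc s ≤ R → s + n ≤ R + (n ∸ 1)
suc≤⇒+≤+∸1 {s} zero    s<R = +-monoˡ-≤ 0 (<⇒≤ s<R)
suc≤⇒+≤+∸1 {s} {R} (suc n) s<R = subst (_≤ R + n) (sym (+-suc s n)) (+-monoˡ-≤ n s<R)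

∑-cong : ∀ {n} {r s : Fin n → ℕ} → r ≗ s → ∑ r ≡ ∑ s
∑-cong {zero}  r≗s = refl
∑-cong {suc n} r≗s = cong₂ _+_ (r≗s zero) (∑-cong (r≗s ∘ suc))

∑-suc : ∀ {n} (r : Fin n → ℕ) → ∑ (suc ∘ r) ≡ ∑ r + n
∑-suc {zero}  r = refl
∑-suc {suc n} r = begin
  suc (r zero + ∑ (suc ∘ r ∘ suc)) ≡⟨ cong (λ s → suc (r zero + s)) (∑-suc (r ∘ suc)) ⟩
  suc (r zero + (∑ (r ∘ suc) + n)) ≡⟨ cong suc (+-assoc (r zero) _ n) ⟨
  suc (∑ r + n)                    ≡⟨ +-suc (∑ r) n ⟨
  ∑ r + suc n                      ∎
  where open ≡-Reasoning

∑-zero : ∀ {n} (r : Fin n → ℕ) → (∀ i → r i ≡ 0) → ∑ r ≡ 0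
∑-zero {zero}  r r≡0 = refl
∑-zero {suc n} r r≡0 = cong₂ _+_ (r≡0 zero) (∑-zero (r ∘ suc) (r≡0 ∘ suc))

∑-updateAt : ∀ {n} (r : Fin n → ℕ) i {a} → r i ≡ suc a → ∑ r ≡ suc (∑ (updateAt r i (const a)))
∑-updateAt {suc n} r zero    rᵢ≡1+a = cong (_+ ∑ (r ∘ suc)) rᵢ≡1+a
∑-updateAt {suc n} r (suc i) rᵢ≡1+a =
  trans (cong (r zero +_) (∑-updateAt (r ∘ suc) i rᵢ≡1+a)) (+-suc (r zero) _)

Extensional : ∀ {V} → BoolFn V → Set
Extensional h = h Preserves _≗_ ⟶ _≡_

weight≡sum : ∀ {n} (x : Fin n → Bool) → weight x ≡ sum (λ i → if x i then 1 else 0)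
weight≡sum {zero}  x = refl
weight≡sum {suc n} x = cong ((if x zero then 1 else 0) +_) (weight≡sum (x ∘ suc))

weight-cong : ∀ {n} {x y : Fin n → Bool} → x ≗ y → weight x ≡ weight y
weight-cong {zero}  x≗y = refl
weight-cong {suc n} x≗y =
  cong₂ _+_ (cong (λ b → if b then 1 else 0) (x≗y zero)) (weight-cong (x≗y ∘ suc))

weight-permute : ∀ {n} (x : Fin n → Bool) (π : Permutation n n) → weight (x ∘ (π ⟨$⟩ʳ_)) ≡ weight x
weight-permute x π = begin
  weight (x ∘ (π ⟨$⟩ʳ_))                        ≡⟨ weight≡sum (x ∘ (π ⟨$⟩ʳ_)) ⟩
  sum ((λ i → if x i then 1 else 0) ∘ (π ⟨$⟩ʳ_)) ≡⟨ sum-permute (λ i → if x i then 1 else 0) π ⟨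
  sum (λ i → if x i then 1 else 0)              ≡⟨ weight≡sum x ⟨
  weight x                                      ∎
  where open ≡-Reasoning

symmetric⇒extensional : ∀ {n} {f : BoolFn (Fin n)} → Symmetric f → Extensional f
symmetric⇒extensional f-sym {x} {y} x≗y = f-sym x y (weight-cong x≗y)

symmetric-transpose : ∀ {n} {f : BoolFn (Fin n)} → Symmetric f → ∀ {x y : Fin n → Bool} i j →
                      y i ≡ x j → y j ≡ x i → (∀ k → k ≢ i → k ≢ j → y k ≡ x k) → f y ≡ f x
symmetric-transpose {f = f} f-sym {x} {y} i j yᵢ≡xⱼ yⱼ≡xᵢ yₖ≡xₖ =
  trans (symmetric⇒extensional f-sym y≗xτ) (f-sym _ x (weight-permute x (transpose i j)))
  where
  y≗xτ : ∀ k → y k ≡ x (PC.transpose i j k)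
  y≗xτ k with k ≟ᶠ i | k ≟ᶠ j
  ... | yes refl | _        = yᵢ≡xⱼ
  ... | no  _    | yes refl rewrite dec-true (k ≟ᶠ k) refl = yⱼ≡xᵢ
  ... | no  k≢i  | no  k≢j  rewrite dec-false (k ≟ᶠ j) k≢j = yₖ≡xₖ k k≢i k≢j

byCases : ∀ {a b} {A : Set a} {B : Set b} → Dec B → (A → B) → (¬ A → B) → B
byCases B? A⇒B ¬A⇒B = decidable-stable B? λ ¬B → ¬B (¬A⇒B (¬B ∘ A⇒B))

module Update {I : Set} (_≟_ : DecidableEquality I) {B : I → Set} where

  _[_]≔_ : ((k : I) → B k) → (i : I) → B i → (k : I) → B k
  (f [ i ]≔ b) k with k ≟ i
  ... | yes refl = b
  ... | no  _    = f k

  update-same : ∀ f i b → (f [ i ]≔ b) i ≡ b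
  update-same f i b with i ≟ i
  ... | yes refl = refl
  ... | no  i≢i  = contradiction refl i≢i

  update-other : ∀ f i b {k} → k ≢ i → (f [ i ]≔ b) k ≡ f k
  update-other f i b {k} k≢i with k ≟ i
  ... | yes k≡i = contradiction k≡i k≢i
  ... | no  _   = refl

  update-elim : ∀ (P : (k : I) → B k → Set) f i b → P i b → (∀ k → k ≢ i → P k (f k)) →
                ∀ k → P k ((f [ i ]≔ b) k)
  update-elim P f i b Pᵢ Pₖ k with k ≟ i
  ... | yes refl = Pᵢ
  ... | no  k≢i  = Pₖ k k≢i

  update-cong : ∀ {f g : (k : I) → B k} → (∀ k → f k ≡ g k) → ∀ i b k → (f [ i ]≔ b) k ≡ (g [ i ]≔ b) k
  update-cong f≗g i b = update-elim (λ k c → c ≡ (_ [ i ]≔ b) k) _ i b (sym (update-same _ i b))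
                          (λ k k≢i → trans (f≗g k) (sym (update-other _ i b k≢i)))

  update-self : ∀ f i b → f i ≡ b → ∀ k → (f [ i ]≔ b) k ≡ f k
  update-self f i b fᵢ≡b = update-elim (λ k c → c ≡ f k) f i b (sym fᵢ≡b) (λ _ _ → refl)

eval-cong : ∀ {V} (t : DTree V) → Extensional (eval t)
eval-cong (leaf b)       x≗y = refl
eval-cong (node v t₀ t₁) {x} {y} x≗y rewrite x≗y v with y v
... | true  = eval-cong t₁ x≗y
... | false = eval-cong t₀ x≗y

computes⇒extensional : ∀ {V} {t : DTree V} {h : BoolFn V} → Computes t h → Extensional h
computes⇒extensional {t = t} c {x} {y} x≗y = trans (sym (c x)) (trans (eval-cong t x≗y) (c y))

Constant : ∀ {V} → BoolFn V → Set
Constant h = ∀ x y → h x ≡ h y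

LowerBound : ∀ {V} → BoolFn V → ℕ → Set
LowerBound {V} h p = (t : DTree V) → Computes t h → p ≤ rank t

lowerBound-mono : ∀ {V} {h : BoolFn V} {p q} → p ≤ q → LowerBound h q → LowerBound h p
lowerBound-mono p≤q lb t c = ≤-trans p≤q (lb t c)

rank≤0⇒constant : ∀ {V} {t : DTree V} {h} → Computes t h → rank t ≤ 0 → Constant h
rank≤0⇒constant {t = leaf b}       c _   x y = trans (sym (c x)) (c y)
rank≤0⇒constant {t = node v t₀ t₁} c r≤0 = contradiction (≤-trans (rankNode-pos _ _) r≤0) λ ()

rank-pos : ∀ {V} {t : DTree V} {h} → NonConstant h → Computes t h → 1 ≤ rank t
rank-pos {t = t} (x , y , hx≢hy) c = ≰⇒> λ rank≤0 → hx≢hy (rank≤0⇒constant {t = t} c rank≤0 x y)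

nonConstant⇒attains : ∀ {V} {h : BoolFn V} → NonConstant h → ∀ c → ∃ λ x → h x ≡ c
nonConstant⇒attains {h = h} (x , y , hx≢hy) c with h x ≟ᴮ c
... | yes hx≡c = x , hx≡c
... | no  hx≢c = y , not-injective (trans (sym (¬-not hx≢hy)) (¬-not hx≢c))

lowerBound⇒attains : ∀ {V} {h : BoolFn V} → LowerBound h 1 → ∀ c → ¬ ¬ ∃ λ x → h x ≡ c
lowerBound⇒attains {h = h} lb c ¬attained = contradiction (lb (leaf (not c)) leaf-computes) λ ()
  where
  leaf-computes : Computes (leaf (not c)) h
  leaf-computes x = sym (¬-not λ hx≡c → ¬attained (x , hx≡c))

mapVar : ∀ {V W} → (V → W) → DTree V → DTree W
mapVar φ (leaf b)       = leaf b
mapVar φ (node v t₀ t₁) = node (φ v) (mapVar φ t₀) (mapVar φ t₁)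

eval-mapVar : ∀ {V W} (φ : V → W) t x → eval (mapVar φ t) x ≡ eval t (x ∘ φ)
eval-mapVar φ (leaf b)       x = refl
eval-mapVar φ (node v t₀ t₁) x rewrite eval-mapVar φ t₀ x | eval-mapVar φ t₁ x = refl

rank-mapVar : ∀ {V W} (φ : V → W) t → rank (mapVar φ t) ≡ rank t
rank-mapVar φ (leaf b)       = refl
rank-mapVar φ (node v t₀ t₁) = cong₂ rankNode (rank-mapVar φ t₀) (rank-mapVar φ t₁)

graft : ∀ {V} → DTree V → (Bool → DTree V) → DTree V
graft (leaf b)       s = s b
graft (node v t₀ t₁) s = node v (graft t₀ s) (graft t₁ s)

eval-graft : ∀ {V} (t : DTree V) s x → eval (graft t s) x ≡ eval (s (eval t x)) x
eval-graft (leaf b)       s x = refl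
eval-graft (node v t₀ t₁) s x with x v
... | true  = eval-graft t₁ s x
... | false = eval-graft t₀ s x

rank-graft : ∀ {V} {c} (t : DTree V) s → (∀ b → rank (s b) ≤ c) → rank (graft t s) ≤ c + rank t
rank-graft {c = c} (leaf b) s rs≤c rewrite +-identityʳ c = rs≤c b
rank-graft {c = c} (node v t₀ t₁) s rs≤c = begin
  rankNode (rank (graft t₀ s)) (rank (graft t₁ s))
    ≤⟨ rankNode-mono (rank-graft t₀ s rs≤c) (rank-graft t₁ s rs≤c) ⟩
  rankNode (c + rank t₀) (c + rank t₁)             ≡⟨ rankNode-+ c (rank t₀) (rank t₁) ⟩
  c + rankNode (rank t₀) (rank t₁)                 ∎
  where open ≤-Reasoning

Vars : ∀ {n} → (Fin n → ℕ) → Set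
Vars {n} m = Σ (Fin n) λ i → Fin (m i)

shiftVar : ∀ {n} {m : Fin (suc n) → ℕ} → Vars (m ∘ suc) → Vars m
shiftVar (i , j) = suc i , j

composeTree : ∀ {n} {m : Fin n → ℕ} → ((i : Fin n) → DTree (Fin (m i))) → BoolFn (Fin n) → DTree (Vars m)
composeTree {zero}  ts f = leaf (f (λ ()))
composeTree {suc n} ts f =
  graft (mapVar (zero ,_) (ts zero))
        (λ b → mapVar shiftVar (composeTree (λ i → ts (suc i)) (f ∘ (b ∷_))))

eval-composeTree : ∀ {n} {m : Fin n → ℕ} (ts : (i : Fin n) → DTree (Fin (m i))) (f : BoolFn (Fin n)) →
                   Extensional f → Computes (composeTree ts f) (compose f (λ i → eval (ts i)))
eval-composeTree {zero}  ts f f-ext x = f-ext (λ ())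
eval-composeTree {suc n} ts f f-ext x = begin
  eval (composeTree ts f) x
    ≡⟨ eval-graft (mapVar (zero ,_) (ts zero)) rest x ⟩
  eval (rest (eval (mapVar (zero ,_) (ts zero)) x)) x
    ≡⟨ cong (λ b → eval (rest b) x) (eval-mapVar (zero ,_) (ts zero) x) ⟩
  eval (rest b₀) x
    ≡⟨ eval-mapVar shiftVar (composeTree ts′ (f ∘ (b₀ ∷_))) x ⟩
  eval (composeTree ts′ (f ∘ (b₀ ∷_))) (x ∘ shiftVar)
    ≡⟨ eval-composeTree ts′ (f ∘ (b₀ ∷_)) (λ z≗z′ → f-ext λ { zero → refl ; (suc i) → z≗z′ i }) _ ⟩
  f (b₀ ∷ (λ i → eval (ts (suc i)) (λ j → x (suc i , j))))
    ≡⟨ f-ext (λ { zero → refl ; (suc i) → refl }) ⟩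
  compose f (λ i → eval (ts i)) x ∎
  where
  open ≡-Reasoning
  ts′ = λ i → ts (suc i)
  rest = λ b → mapVar shiftVar (composeTree ts′ (f ∘ (b ∷_)))
  b₀ = eval (ts zero) (λ j → x (zero , j))

rank-composeTree : ∀ {n} {m : Fin n → ℕ} (ts : (i : Fin n) → DTree (Fin (m i))) f →
                   rank (composeTree ts f) ≤ ∑ (λ i → rank (ts i))
rank-composeTree {zero}  ts f = z≤n
rank-composeTree {suc n} ts f = begin
  rank (composeTree ts f)                      ≤⟨ rank-graft (mapVar (zero ,_) (ts zero)) _ rest≤ ⟩
  ∑ ranks′ + rank (mapVar (zero ,_) (ts zero)) ≡⟨ cong (∑ ranks′ +_) (rank-mapVar (zero ,_) (ts zero)) ⟩
  ∑ ranks′ + rank (ts zero)                    ≡⟨ +-comm (∑ ranks′) (rank (ts zero)) ⟩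
  rank (ts zero) + ∑ ranks′                    ∎
  where
  open ≤-Reasoning
  ranks′ = λ i → rank (ts (suc i))
  rest≤ : ∀ b → rank (mapVar shiftVar (composeTree (λ i → ts (suc i)) (f ∘ (b ∷_)))) ≤ ∑ ranks′
  rest≤ b = ≤-trans (≤-reflexive (rank-mapVar shiftVar (composeTree (λ i → ts (suc i)) (f ∘ (b ∷_)))))
                    (rank-composeTree (λ i → ts (suc i)) (f ∘ (b ∷_)))

isRank-compose-≤ : ∀ {n} {m : Fin n → ℕ} {g : (i : Fin n) → BoolFn (Fin (m i))} {r f R} →
                   Extensional f → (∀ i → IsRank (g i) (r i)) → IsRank (compose f g) R → R ≤ ∑ r
isRank-compose-≤ {g = g} {r} {f} {R} f-ext g-rank (_ , R-minimal) = begin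
  R                             ≤⟨ R-minimal (composeTree trees f) computes ⟩
  rank (composeTree trees f)    ≤⟨ rank-composeTree trees f ⟩
  ∑ (λ i → rank (trees i))      ≡⟨ ∑-cong (λ i → proj₂ (proj₂ (proj₁ (g-rank i)))) ⟩
  ∑ r                           ∎
  where
  open ≤-Reasoning
  trees = λ i → proj₁ (proj₁ (g-rank i))
  computes : Computes (composeTree trees f) (compose f g)
  computes x = trans (eval-composeTree trees f f-ext x) (f-ext λ i → proj₁ (proj₂ (proj₁ (g-rank i))) _)

depth : ∀ {V} → DTree V → ℕ
depth (leaf _)       = 0
depth (node _ t₀ t₁) = suc (depth t₀ ⊔ depth t₁)

branch : ∀ {V} → Bool → DTree V → DTree V → DTree V
branch e t₀ t₁ = if e then t₁ else t₀

rank-branch : ∀ {V} e (t₀ t₁ : DTree V) → rank (branch e t₀ t₁) ≤ rankNode (rank t₀) (rank t₁)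
rank-branch false t₀ t₁ = rankNode-≥ˡ (rank t₀) (rank t₁)
rank-branch true  t₀ t₁ = rankNode-≥ʳ (rank t₀) (rank t₁)

depth-branch : ∀ {V} e (t₀ t₁ : DTree V) → depth (branch e t₀ t₁) ≤ depth t₀ ⊔ depth t₁
depth-branch false t₀ t₁ = m≤m⊔n (depth t₀) (depth t₁)
depth-branch true  t₀ t₁ = m≤n⊔m (depth t₀) (depth t₁)

eval-node : ∀ {V} v (t₀ t₁ : DTree V) {x} {e} → x v ≡ e → eval (node v t₀ t₁) x ≡ eval (branch e t₀ t₁) x
eval-node v t₀ t₁ {x} refl with x v
... | true  = refl
... | false = refl

module Restriction {V : Set} (_≟_ : DecidableEquality V) where

  open Update _≟_

  prune : V → Bool → DTree V → DTree V
  prune v e (leaf b) = leaf b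
  prune v e (node w t₀ t₁) with w ≟ v
  ... | yes _ = branch e (prune v e t₀) (prune v e t₁)
  ... | no  _ = node w (prune v e t₀) (prune v e t₁)

  eval-prune : ∀ v e t x → eval (prune v e t) x ≡ eval t (x [ v ]≔ e)
  eval-prune v e (leaf b) x = refl
  eval-prune v e (node w t₀ t₁) x with w ≟ v
  ... | yes refl = eval-branch e
    where
    eval-branch : ∀ e → eval (branch e (prune v e t₀) (prune v e t₁)) x ≡
                        (if e then eval t₁ (x [ v ]≔ e) else eval t₀ (x [ v ]≔ e))
    eval-branch false = eval-prune v false t₀ x
    eval-branch true  = eval-prune v true t₁ x
  ... | no _ with x w
  ...   | true  = eval-prune v e t₁ x
  ...   | false = eval-prune v e t₀ x

  rank-prune : ∀ v e t → rank (prune v e t) ≤ rank t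
  rank-prune v e (leaf b) = z≤n
  rank-prune v e (node w t₀ t₁) with w ≟ v
  ... | yes _ = ≤-trans (rank-branch-prune e) (rank-branch e t₀ t₁)
    where
    rank-branch-prune : ∀ e → rank (branch e (prune v e t₀) (prune v e t₁)) ≤ rank (branch e t₀ t₁)
    rank-branch-prune false = rank-prune v false t₀
    rank-branch-prune true  = rank-prune v true t₁
  ... | no  _ = rankNode-mono (rank-prune v e t₀) (rank-prune v e t₁)

  depth-prune : ∀ v e t → depth (prune v e t) ≤ depth t
  depth-prune v e (leaf b) = z≤n
  depth-prune v e (node w t₀ t₁) with w ≟ v
  ... | yes _ = ≤-trans (depth-branch-prune e) (m≤n⇒m≤1+n (depth-branch e t₀ t₁))
    where
    depth-branch-prune : ∀ e → depth (branch e (prune v e t₀) (prune v e t₁)) ≤ depth (branch e t₀ t₁)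
    depth-branch-prune false = depth-prune v false t₀
    depth-branch-prune true  = depth-prune v true t₁
  ... | no  _ = s≤s (⊔-mono-≤ (depth-prune v e t₀) (depth-prune v e t₁))

  prune-computes : ∀ {h : BoolFn V} v e t₀ t₁ → Computes (node v t₀ t₁) h →
                   Computes (prune v e (branch e t₀ t₁)) (λ x → h (x [ v ]≔ e))
  prune-computes v e t₀ t₁ c x = begin
    eval (prune v e (branch e t₀ t₁)) x ≡⟨ eval-prune v e (branch e t₀ t₁) x ⟩
    eval (branch e t₀ t₁) (x [ v ]≔ e)  ≡⟨ eval-node v t₀ t₁ (update-same x v e) ⟨
    eval (node v t₀ t₁) (x [ v ]≔ e)    ≡⟨ c (x [ v ]≔ e) ⟩
    _                                   ∎
    where open ≡-Reasoning

  restrict : V → Bool → BoolFn V → BoolFn V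
  restrict v e h x = h (x [ v ]≔ e)

  restrict-extensional : ∀ {h} v e → Extensional h → Extensional (restrict v e h)
  restrict-extensional v e h-ext x≗y = h-ext (update-cong x≗y v e)

  node-computes : ∀ {h} {v t₀ t₁} → Extensional h →
                  Computes t₀ (restrict v false h) → Computes t₁ (restrict v true h) → Computes (node v t₀ t₁) h
  node-computes {v = v} h-ext c₀ c₁ x with x v in xᵥ
  ... | false = trans (c₀ x) (h-ext (update-self x v false xᵥ))
  ... | true  = trans (c₁ x) (h-ext (update-self x v true xᵥ))

  lowerBound-restrict : ∀ {h} {k} v e {t′} → Extensional h → LowerBound h (suc k) →
                        Computes t′ (restrict v (not e) h) → rank t′ ≤ k → LowerBound (restrict v e h) k
  lowerBound-restrict v false {t′} h-ext lb c′ r′≤k t c =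
    suc≤rankNode⇒≤ˡ (lb (node v t t′) (node-computes {t₀ = t} {t′} h-ext c c′)) r′≤k
  lowerBound-restrict v true  {t′} h-ext lb c′ r′≤k t c =
    suc≤rankNode⇒≤ʳ (lb (node v t′ t) (node-computes {t₀ = t′} {t} h-ext c′ c)) r′≤k

Budgeted : ∀ {W} → BoolFn W → ℕ → Set
Budgeted h k = LowerBound h (suc k) ⊎ (k ≡ 0 × Constant h)

module Adversary {n : ℕ} {m : Fin n → ℕ} (f : BoolFn (Fin n)) (f-sym : Symmetric f) where

  V : Set
  V = Vars m

  Family : Set
  Family = (i : Fin n) → BoolFn (Fin (m i))

  _≟ⱽ_ : DecidableEquality V
  _≟ⱽ_ = ≡-dec _≟ᶠ_ _≟ᶠ_

  module Var = Update _≟ⱽ_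
  module Block = Update (_≟ᶠ_ {n})
  module Entry {k} = Update (_≟ᶠ_ {k})
  module Inner {k} = Restriction (_≟ᶠ_ {k})
  open Restriction _≟ⱽ_ using (prune; rank-prune; depth-prune; prune-computes)

  f-ext : Extensional f
  f-ext = symmetric⇒extensional f-sym

  compose-extensional : ∀ {h : Family} → (∀ i → Extensional (h i)) → Extensional (compose f h)
  compose-extensional h-ext x≗y = f-ext λ i → h-ext i λ j → x≗y (i , j)

  restrictAt : Family → V → Bool → Family
  restrictAt h (i , j) e = h Block.[ i ]≔ Inner.restrict j e (h i)

  restrictAt-other : ∀ (h : Family) {i} j e {k} → k ≢ i → restrictAt h (i , j) e k ≡ h k
  restrictAt-other h {i} j e k≢i = Block.update-other h i _ k≢i

  compose-restrictAt : ∀ {h} → (∀ i → Extensional (h i)) → ∀ v e x →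
                       compose f h (x Var.[ v ]≔ e) ≡ compose f (restrictAt h v e) x
  compose-restrictAt {h} h-ext (i , j) e x =
    f-ext (Block.update-elim {B = λ k → BoolFn (Fin (m k))} P h i _ at-i at-other)
    where
    P : (k : Fin n) → BoolFn (Fin (m k)) → Set
    P k g = h k (λ j′ → (x Var.[ i , j ]≔ e) (k , j′)) ≡ g (λ j′ → x (k , j′))
    at-i : P i (Inner.restrict j e (h i))
    at-i = h-ext i at-j
      where
      at-j : ∀ j′ → (x Var.[ i , j ]≔ e) (i , j′) ≡ ((λ j′ → x (i , j′)) Entry.[ j ]≔ e) j′
      at-j j′ with j′ ≟ᶠ j
      ... | yes refl = Var.update-same x (i , j) e
      ... | no  j′≢j = Var.update-other x (i , j) e λ { refl → j′≢j refl }
    at-other : ∀ k → k ≢ i → P k (h k)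
    at-other k k≢i = h-ext k λ j′ → Var.update-other x (i , j) e (k≢i ∘ cong proj₁)

  compose-restrictAt-self : ∀ {h} → (∀ i → Extensional (h i)) → ∀ v x →
                            compose f h x ≡ compose f (restrictAt h v (x v)) x
  compose-restrictAt-self h-ext v x =
    trans (sym (compose-extensional h-ext (Var.update-self x v (x v) refl))) (compose-restrictAt h-ext v (x v) x)

  compose-update : ∀ {h : Family} {ys : (k : Fin n) → Fin (m k) → Bool} i {g y} → g y ≡ h i (ys i) →
                   compose f (h Block.[ i ]≔ g) (uncurry (ys Block.[ i ]≔ y)) ≡ compose f h (uncurry ys)
  compose-update {h} {ys} i {g} {y} gy≡hᵢ = f-ext at
    where
    at : ∀ k → (h Block.[ i ]≔ g) k ((ys Block.[ i ]≔ y) k) ≡ h k (ys k)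
    at k with k ≟ᶠ i
    ... | yes refl = gy≡hᵢ
    ... | no  _    = refl

  compose-nonConstant : ∀ {h : Family} → (∀ i → NonConstant (h i)) → NonConstant f → ¬ Constant (compose f h)
  compose-nonConstant {h} h-nc (z , z′ , fz≢fz′) C =
    fz≢fz′ (trans (sym (realise z)) (trans (C _ _) (realise z′)))
    where
    realise : ∀ z → compose f h (uncurry λ i → proj₁ (nonConstant⇒attains (h-nc i) (z i))) ≡ f z
    realise z = f-ext λ i → proj₂ (nonConstant⇒attains (h-nc i) (z i))

  restrictAt-nonConstant : ∀ {h} i j e → (∀ y → ¬ ¬ ∃ λ y′ → Inner.restrict j e (h i) y′ ≡ h i y) →
                           ¬ Constant (compose f h) → ¬ Constant (compose f (restrictAt h (i , j) e))
  restrictAt-nonConstant {h} i j e covers ¬C C′ =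
    ¬C λ x x′ → trans (agrees x) (trans (C′ x x′) (sym (agrees x′)))
    where
    agrees : ∀ x → compose f h x ≡ compose f (restrictAt h (i , j) e) x
    agrees x = decidable-stable (_ ≟ᴮ _) λ ≢ → covers (λ j′ → x (i , j′)) λ (y′ , eq) →
      ≢ (trans (sym (compose-update {ys = λ k j′ → x (k , j′)} i eq)) (C′ _ x))

  -- Block l still takes both values, so the two branches are evaluated at value vectors differing by
  -- an exchange of the entries i and l, on which the symmetric f agrees.
  restrictAt-swap : ∀ {h} i j {l} → l ≢ i → LowerBound (h l) 1 → (∀ e → Constant (Inner.restrict j e (h i))) →
                    (∀ e → Constant (compose f (restrictAt h (i , j) e))) →
                    ∀ x y → compose f (restrictAt h (i , j) false) x ≡ compose f (restrictAt h (i , j) true) y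
  restrictAt-swap {h} i j {l} l≢i lb₁ hᵢ-const C x y =
    decidable-stable (_ ≟ᴮ _) λ ≢ →
      lowerBound⇒attains lb₁ (b true)  λ (y₁ , hy₁) →
      lowerBound⇒attains lb₁ (b false) λ (y₀ , hy₀) → ≢ (begin
        compose f (restrictAt h (i , j) false) x ≡⟨ C false x _ ⟩
        f (values false y₁)                      ≡⟨ swapped hy₀ hy₁ ⟨
        f (values true y₀)                       ≡⟨ C true _ y ⟩
        compose f (restrictAt h (i , j) true) y  ∎)
    where
    open ≡-Reasoning
    ys₀ : (k : Fin n) → Fin (m k) → Bool
    ys₀ _ _ = false
    b : Bool → Bool
    b e = Inner.restrict j e (h i) (ys₀ i)
    values : Bool → (Fin (m l) → Bool) → Fin n → Bool
    values e y k = restrictAt h (i , j) e k ((ys₀ Block.[ l ]≔ y) k)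
    values-i : ∀ e y → values e y i ≡ b e
    values-i e y = trans (cong-app (Block.update-same h i _) _) (hᵢ-const e _ _)
    values-l : ∀ e y → values e y l ≡ h l y
    values-l e y = trans (cong-app (restrictAt-other h j e l≢i) _) (cong (h l) (Block.update-same ys₀ l y))
    values-other : ∀ e y k → k ≢ i → k ≢ l → values e y k ≡ h k (ys₀ k)
    values-other e y k k≢i k≢l =
      trans (cong-app (restrictAt-other h j e k≢i) _) (cong (h k) (Block.update-other ys₀ l y k≢l))
    swapped : ∀ {y₀ y₁} → h l y₀ ≡ b false → h l y₁ ≡ b true → f (values true y₀) ≡ f (values false y₁)
    swapped {y₀} {y₁} hy₀ hy₁ = symmetric-transpose f-sym i l
      (trans (values-i true y₀) (sym (trans (values-l false y₁) hy₁)))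
      (trans (values-l true y₀) (trans hy₀ (sym (values-i false y₁))))
      (λ k k≢i k≢l → trans (values-other true y₀ k k≢i k≢l) (sym (values-other false y₁ k k≢i k≢l)))

  restrictAt-constant⇒constant : ∀ {h} i j {l} → (∀ k → Extensional (h k)) → l ≢ i → LowerBound (h l) 1 →
                                 (∀ e → Constant (Inner.restrict j e (h i))) →
                                 (∀ e → Constant (compose f (restrictAt h (i , j) e))) → Constant (compose f h)
  restrictAt-constant⇒constant {h} i j h-ext l≢i lb₁ hᵢ-const C x y = begin
    compose f h x                                  ≡⟨ compose-restrictAt-self h-ext (i , j) x ⟩
    compose f (restrictAt h (i , j) (x (i , j))) x ≡⟨ agree (x (i , j)) (y (i , j)) ⟩
    compose f (restrictAt h (i , j) (y (i , j))) y ≡⟨ compose-restrictAt-self h-ext (i , j) y ⟨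
    compose f h y                                  ∎
    where
    open ≡-Reasoning
    swap = restrictAt-swap i j l≢i lb₁ hᵢ-const C
    agree : ∀ e e′ → compose f (restrictAt h (i , j) e) x ≡ compose f (restrictAt h (i , j) e′) y
    agree false false = C false x y
    agree true  true  = C true x y
    agree false true  = swap x y
    agree true  false = sym (swap y x)

  record Hard (h : Family) (k : Fin n → ℕ) : Set where
    field
      extensional : ∀ i → Extensional (h i)
      budgeted    : ∀ i → Budgeted (h i) (k i)
      nonConstant : ¬ Constant (compose f h)

  hard-restrict : ∀ {h k} → Hard h k → ∀ i j e {κ} → Budgeted (Inner.restrict j e (h i)) (κ i) →
                  (∀ l → l ≢ i → κ l ≡ k l) → ¬ Constant (compose f (restrictAt h (i , j) e)) →
                  Hard (restrictAt h (i , j) e) κ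
  hard-restrict {h} H i j e {κ} bᵢ κ≡k ¬C = record
    { extensional = Block.update-elim (λ _ g → Extensional g) h i _
                      (Inner.restrict-extensional j e (extensional i)) (λ l _ → extensional l)
    ; budgeted    = Block.update-elim (λ l g → Budgeted g (κ l)) h i _
                      bᵢ (λ l l≢i → subst (Budgeted (h l)) (sym (κ≡k l l≢i)) (budgeted l))
    ; nonConstant = ¬C
    }
    where open Hard H

  Bound : DTree V → Set
  Bound T = ∀ h k → Hard h k → Computes T (compose f h) → suc (∑ k) ≤ rank T

  module Node (i : Fin n) (j : Fin (m i)) (t₀ t₁ : DTree V)
              (IH : ∀ e → Bound (prune (i , j) e (branch e t₀ t₁)))
              {h : Family} {k : Fin n → ℕ} (H : Hard h k)
              (c : Computes (node (i , j) t₀ t₁) (compose f h)) where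

    open Hard H

    Goal : Set
    Goal = suc (∑ k) ≤ rankNode (rank t₀) (rank t₁)

    hᵢ : Bool → BoolFn (Fin (m i))
    hᵢ e = Inner.restrict j e (h i)

    Small : Bool → Set
    Small e = ∃ λ t → Computes t (hᵢ e) × rank t ≤ k i

    descend : ∀ e {κ} → Hard (restrictAt h (i , j) e) κ → suc (∑ κ) ≤ rank (branch e t₀ t₁)
    descend e {κ} H′ = ≤-trans (IH e _ κ H′ computes) (rank-prune (i , j) e (branch e t₀ t₁))
      where
      computes : Computes (prune (i , j) e (branch e t₀ t₁)) (compose f (restrictAt h (i , j) e))
      computes x = trans (prune-computes (i , j) e t₀ t₁ c x) (compose-restrictAt extensional (i , j) e x)

    follow : ∀ e → Hard (restrictAt h (i , j) e) k → Goal
    follow e H′ = ≤-trans (descend e H′) (rank-branch e t₀ t₁)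

    restrictLive : ∀ e {κ} → LowerBound (hᵢ e) (suc (κ i)) → (∀ l → l ≢ i → κ l ≡ k l) →
                   Hard (restrictAt h (i , j) e) κ
    restrictLive e lb κ≡k =
      hard-restrict H i j e (inj₁ lb) κ≡k (restrictAt-nonConstant i j e covers nonConstant)
      where
      covers : ∀ y → ¬ ¬ ∃ λ y′ → hᵢ e y′ ≡ h i y
      covers y = lowerBound⇒attains (lowerBound-mono (s≤s z≤n) lb) (h i y)

    followLive : ∀ e → ¬ Small e → Goal
    followLive e ¬small = follow e (restrictLive e lb λ _ _ → refl)
      where
      lb : LowerBound (hᵢ e) (suc (k i))
      lb t cₜ = ≰⇒> λ rank≤kᵢ → ¬small (t , cₜ , rank≤kᵢ)

    dropBudget : LowerBound (h i) (suc (k i)) → ∀ {k′} → k i ≡ suc k′ → Small false → Small true → Goal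
    dropBudget lb {k′} kᵢ≡1+k′ small₀ small₁ =
      subst (_≤ rankNode (rank t₀) (rank t₁)) (cong suc (sym (∑-updateAt k i kᵢ≡1+k′)))
            (rankNode-suc (descend false (restrict false small₁)) (descend true (restrict true small₀)))
      where
      κ = updateAt k i (const k′)
      restrict : ∀ e → Small (not e) → Hard (restrictAt h (i , j) e) κ
      restrict e (t′ , c′ , r′) = restrictLive e
        (subst (LowerBound (hᵢ e)) (trans kᵢ≡1+k′ (cong suc (sym (updateAt-updates i k))))
               (Inner.lowerBound-restrict j e {t′} (extensional i) lb c′ r′))
        (λ l l≢i → updateAt-minimal l i k l≢i)

    fixBlock : k i ≡ 0 → Small false → Small true → Goal
    fixBlock kᵢ≡0 small₀ small₁ =
      byCases (_ ≤? _) (λ C₀ → byCases (_ ≤? _) (λ C₁ → bothConstant λ { false → C₀ ; true → C₁ })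
                                                 (fixAs true))
                       (fixAs false)
      where
      small⇒constant : ∀ {e} → Small e → Constant (hᵢ e)
      small⇒constant (t′ , c′ , r′) = rank≤0⇒constant {t = t′} c′ (≤-trans r′ (≤-reflexive kᵢ≡0))
      hᵢ-const : ∀ e → Constant (hᵢ e)
      hᵢ-const false = small⇒constant small₀
      hᵢ-const true  = small⇒constant small₁
      fixAs : ∀ e → ¬ Constant (compose f (restrictAt h (i , j) e)) → Goal
      fixAs e ¬C = follow e (hard-restrict H i j e (inj₂ (kᵢ≡0 , hᵢ-const e)) (λ _ _ → refl) ¬C)
      budget-zero : ¬ (∃ λ l → l ≢ i × LowerBound (h l) (suc (k l))) → ∀ l → k l ≡ 0
      budget-zero ¬live l with l ≟ᶠ i | budgeted l
      ... | yes refl | _               = kᵢ≡0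
      ... | no  l≢i  | inj₁ lbₗ        = ⊥-elim (¬live (l , l≢i , lbₗ))
      ... | no  _    | inj₂ (kₗ≡0 , _) = kₗ≡0
      bothConstant : (∀ e → Constant (compose f (restrictAt h (i , j) e))) → Goal
      bothConstant C = byCases (_ ≤? _)
        (λ (l , l≢i , lbₗ) → ⊥-elim (nonConstant
          (restrictAt-constant⇒constant i j extensional l≢i (lowerBound-mono (s≤s z≤n) lbₗ) hᵢ-const C)))
        (λ ¬live → subst (_≤ rankNode (rank t₀) (rank t₁)) (cong suc (sym (∑-zero k (budget-zero ¬live))))
                         (rankNode-pos _ _))

    bound : Goal
    bound with budgeted i
    ... | inj₂ (kᵢ≡0 , hᵢ-const) =
      follow false (hard-restrict H i j false (inj₂ (kᵢ≡0 , λ _ _ → hᵢ-const _ _)) (λ _ _ → refl)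
        (restrictAt-nonConstant i j false (λ y ¬covered → ¬covered (y , hᵢ-const _ _)) nonConstant))
    ... | inj₁ lb =
      byCases (_ ≤? _) (λ small₀ → byCases (_ ≤? _) (both-small (k i) refl small₀) (followLive true))
                       (followLive false)
      where
      both-small : ∀ kᵢ → k i ≡ kᵢ → Small false → Small true → Goal
      both-small zero     kᵢ≡0    = fixBlock kᵢ≡0
      both-small (suc k′) kᵢ≡1+k′ = dropBudget lb kᵢ≡1+k′

  -- Induction on depth: the pruned subtrees are not structural subterms.
  adversary : ∀ d T → depth T ≤ d → Bound T
  adversary d       (leaf b)             _             h k H c =
    ⊥-elim (Hard.nonConstant H λ x y → trans (sym (c x)) (c y))
  adversary (suc d) (node (i , j) t₀ t₁) (s≤s depth≤d) h k H c = Node.bound i j t₀ t₁ IH H c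
    where
    IH : ∀ e → Bound (prune (i , j) e (branch e t₀ t₁))
    IH e = adversary d _ (≤-trans (depth-prune (i , j) e _) (≤-trans (depth-branch e t₀ t₁) depth≤d))

  isRank-compose-≥ : ∀ {g : Family} {r R} → (∀ i → NonConstant (g i)) → (∀ i → IsRank (g i) (r i)) →
                     NonConstant f → IsRank (compose f g) R → ∑ r ≤ R + (n ∸ 1)
  isRank-compose-≥ {g} {r} {R} g-nc g-rank f-nc ((T , T-computes , rank≡R) , _) =
    subst (_≤ R + (n ∸ 1)) (sym ∑r≡∑k+n)
      (suc≤⇒+≤+∸1 n (subst (suc (∑ k) ≤_) rank≡R (adversary (depth T) T ≤-refl g k hard T-computes)))
    where
    k : Fin n → ℕ
    k i = pred (r i)
    rᵢ≡1+kᵢ : ∀ i → r i ≡ suc (k i)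
    rᵢ≡1+kᵢ i = let ((t , t-computes , rank≡rᵢ) , _) = g-rank i in
      sym (suc-pred (r i) {{>-nonZero (subst (1 ≤_) rank≡rᵢ (rank-pos {t = t} (g-nc i) t-computes))}})
    ∑r≡∑k+n : ∑ r ≡ ∑ k + n
    ∑r≡∑k+n = trans (∑-cong rᵢ≡1+kᵢ) (∑-suc k)
    hard : Hard g k
    hard = record
      { extensional = λ i → let ((t , t-computes , _) , _) = g-rank i in computes⇒extensional {t = t} t-computes
      ; budgeted    = λ i → inj₁ (subst (LowerBound (g i)) (rᵢ≡1+kᵢ i) (proj₂ (g-rank i)))
      ; nonConstant = compose-nonConstant g-nc f-nc
      }

corollary6p7 : (n : ℕ) (m : Fin n → ℕ) (g : (i : Fin n) → BoolFn (Fin (m i)))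
    (r : Fin n → ℕ) (f : BoolFn (Fin n)) (R : ℕ) →
    ((i : Fin n) → NonConstant (g i)) →
    ((i : Fin n) → IsRank (g i) (r i)) →
    NonConstant f → Symmetric f →
    IsRank (compose f g) R →
    (∑ r ≤ R + (n ∸ 1)) × (R ≤ ∑ r)
corollary6p7 n m g r f R g-nc g-rank f-nc f-sym R-rank =
  Adversary.isRank-compose-≥ f f-sym g-nc g-rank f-nc R-rank ,
  isRank-compose-≤ (symmetric⇒extensional f-sym) g-rank R-rank
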